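{- For all $n,k \geq 2$ we have $ex(n;k) \geq \lfloor n^2/4 \rfloor$.
   Context: A digraph has a vertex set and an arc set consisting of ordered pairs of distinct vertices. A walk of length $\ell$ is a sequence $x_0x_1\dots x_\ell$ of vertices with $x_i \rightarrow x_{i+1}$ for all $i$. A digraph is $k$-geodetic if for every ordered pair $(u,v)$ of (not necessarily distinct) vertices there is at most one $u,v$-walk of length at most $k$. For $n,k\ge 2$, $ex(n;k)$ is the largest possible number of arcs of a $k$-geodetic digraph on $n$ vertices. -}

module Defs where

open import Data.Nat using (ℕ; zero; suc; _≤_)
open import Data.Fin using (Fin)
open import Data.Bool using (Bool; true; false; T; if_then_else_)
open import Data.List using (List; map; allFin)
open import Data.Nat.ListAction using (sum)
open import Data.Product using (Σ; _,_)
open import Relation.Binary.PropositionalEquality using (_≡_)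

record Digraph (n : ℕ) : Set where
  field
    arc       : Fin n → Fin n → Bool
    loopless  : ∀ v → arc v v ≡ false
open Digraph public

-- Walks of length ℓ from u to v: x₀ = u, …, x_ℓ = v with x_i → x_{i+1}.
-- (The arc proofs live in T b, which has at most one element, so equality of
-- walks is equality of the vertex sequences.)
data Walk {n : ℕ} (G : Digraph n) : Fin n → Fin n → ℕ → Set where
  []  : ∀ {u} → Walk G u u zero
  _∷_ : ∀ {u w v ℓ} → T (arc G u w) → Walk G w v ℓ → Walk G u v (suc ℓ)

KGeodetic : ∀ {n} → ℕ → Digraph n → Set
KGeodetic {n} k G =
  ∀ (u v : Fin n) (ℓ₁ ℓ₂ : ℕ) → ℓ₁ ≤ k → ℓ₂ ≤ k →
  (p : Walk G u v ℓ₁) (q : Walk G u v ℓ₂) →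
  _≡_ {A = Σ ℕ (Walk G u v)} (ℓ₁ , p) (ℓ₂ , q)

arcCount : ∀ {n} → Digraph n → ℕ
arcCount {n} G =
  sum (map (λ u → sum (map (λ v → if arc G u v then 1 else 0) (allFin n))) (allFin n))

-- Split the vertices into a low half {i < ⌊n/2⌋} and a high half, and orient
-- every pair from low to high. The ⌊n/2⌋ ⌈n/2⌉ = ⌊n²/4⌋ arcs form no walk of
-- length 2, so the only walks are the trivial ones and single arcs, and those
-- are unique: the digraph is k-geodetic for every k.
module Submission where

open import Defs
open import Data.Nat using (ℕ; _≤_; _*_)
open import Data.Nat.DivMod using (_/_)
open import Data.Product using (Σ; _×_)

open import Data.Nat using (zero; suc; _+_; _∸_; _⊓_; _<_; _<ᵇ_; ⌊_/2⌋; ⌈_/2⌉)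
open import Data.Nat.Properties
open import Data.Nat.DivMod using (m<n*o⇒m/o<n)
open import Data.Nat.ListAction using (sum)
open import Data.Nat.Tactic.RingSolver using (solve-∀)
open import Data.Fin using (toℕ)
open import Data.Bool using (true; false; not; _∧_; T; if_then_else_)
open import Data.Bool.Properties using (T-irrelevant; T-∧; T-not-≡; ∧-inverseʳ; if-eta; if-not)
open import Data.List using (map; allFin; tabulate)
open import Data.List.Properties using (map-cong; map-tabulate)
open import Data.Product using (_,_; proj₁; proj₂)
open import Data.Sum using (_⊎_; inj₁; inj₂)
import Data.Sum as Sum
open import Data.Empty using (⊥-elim)
open import Function using (id)
open import Function.Bundles using (Equivalence)
open import Relation.Nullary using (¬_)
open import Relation.Binary.PropositionalEquality

noTwoWalks⇒KGeodetic : ∀ {n} (G : Digraph n) → (∀ {u v} → ¬ Walk G u v 2) →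
                       ∀ k → KGeodetic k G
noTwoWalks⇒KGeodetic G no2walk k u v _ _ _ _ = unique
  where
  unique : ∀ {u v ℓ₁ ℓ₂} (p : Walk G u v ℓ₁) (q : Walk G u v ℓ₂) →
           _≡_ {A = Σ ℕ (Walk G u v)} (ℓ₁ , p) (ℓ₂ , q)
  unique (e ∷ (e′ ∷ _)) _              = ⊥-elim (no2walk (e ∷ (e′ ∷ [])))
  unique _              (e ∷ (e′ ∷ _)) = ⊥-elim (no2walk (e ∷ (e′ ∷ [])))
  unique []             []             = refl
  unique {u} []         (e ∷ [])       = ⊥-elim (subst T (loopless G u) e)
  unique {u} (e ∷ [])   []             = ⊥-elim (subst T (loopless G u) e)
  unique (e ∷ [])       (e′ ∷ [])      = cong (λ e″ → 1 , (e″ ∷ [])) (T-irrelevant e e′)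

lowToHigh : ∀ n → ℕ → Digraph n
lowToHigh n a = record
  { arc      = λ u v → (toℕ u <ᵇ a) ∧ not (toℕ v <ᵇ a)
  ; loopless = λ v → ∧-inverseʳ (toℕ v <ᵇ a)
  }

lowToHigh-noTwoWalks : ∀ n a {u v} → ¬ Walk (lowToHigh n a) u v 2
lowToHigh-noTwoWalks n a {u} {v} (_∷_ {w = w} uw (wv ∷ [])) =
  subst T (Equivalence.to T-not-≡ (proj₂ (Equivalence.to (T-∧ {toℕ u <ᵇ a}) uw)))
          (proj₁ (Equivalence.to (T-∧ {toℕ w <ᵇ a}) wv))

sum-threshold : ∀ n a (x y : ℕ) →
  sum (map (λ i → if toℕ i <ᵇ a then x else y) (allFin n)) ≡ (a ⊓ n) * x + (n ∸ a) * y
sum-threshold n a x y = trans (cong sum (map-tabulate {n = n} id _)) (go n a)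
  where
  go : ∀ n a → sum (tabulate {n = n} (λ i → if toℕ i <ᵇ a then x else y)) ≡
               (a ⊓ n) * x + (n ∸ a) * y
  go zero    zero    = refl
  go zero    (suc a) = refl
  go (suc n) zero    = cong (y +_) (go n zero)
  go (suc n) (suc a) = trans (cong (x +_) (go n a)) (sym (+-assoc x _ _))

arcCount-lowToHigh : ∀ n a → arcCount (lowToHigh n a) ≡ (a ⊓ n) * (n ∸ a)
arcCount-lowToHigh n a = begin
  arcCount (lowToHigh n a)
    ≡⟨ cong sum (map-cong outdegree (allFin n)) ⟩
  sum (map (λ u → if toℕ u <ᵇ a then n ∸ a else 0) (allFin n))
    ≡⟨ sum-threshold n a (n ∸ a) 0 ⟩
  (a ⊓ n) * (n ∸ a) + (n ∸ a) * 0
    ≡⟨ cong ((a ⊓ n) * (n ∸ a) +_) (*-zeroʳ (n ∸ a)) ⟩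
  (a ⊓ n) * (n ∸ a) + 0
    ≡⟨ +-identityʳ _ ⟩
  (a ⊓ n) * (n ∸ a) ∎
  where
  open ≡-Reasoning
  outdegree : ∀ u → sum (map (λ v → if arc (lowToHigh n a) u v then 1 else 0) (allFin n)) ≡
                    (if toℕ u <ᵇ a then n ∸ a else 0)
  outdegree u with toℕ u <ᵇ a
  ... | false = begin
    sum (map (λ _ → 0) (allFin n))
      ≡⟨ cong sum (map-cong (λ v → sym (if-eta (toℕ v <ᵇ a))) (allFin n)) ⟩
    sum (map (λ v → if toℕ v <ᵇ a then 0 else 0) (allFin n))
      ≡⟨ sum-threshold n a 0 0 ⟩
    (a ⊓ n) * 0 + (n ∸ a) * 0
      ≡⟨ cong₂ _+_ (*-zeroʳ (a ⊓ n)) (*-zeroʳ (n ∸ a)) ⟩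
    0 ∎
  ... | true  = begin
    sum (map (λ v → if not (toℕ v <ᵇ a) then 1 else 0) (allFin n))
      ≡⟨ cong sum (map-cong (λ v → if-not (toℕ v <ᵇ a)) (allFin n)) ⟩
    sum (map (λ v → if toℕ v <ᵇ a then 0 else 1) (allFin n))
      ≡⟨ sum-threshold n a 0 1 ⟩
    (a ⊓ n) * 0 + (n ∸ a) * 1
      ≡⟨ cong₂ _+_ (*-zeroʳ (a ⊓ n)) (*-identityʳ (n ∸ a)) ⟩
    n ∸ a ∎

-- (m + n)² = 4 m n + (n − m)², and (n − m)² ≤ 1 here.
[m+n]*[m+n]/4≤m*n : ∀ m n → n ≡ m ⊎ n ≡ suc m → (m + n) * (m + n) / 4 ≤ m * n
[m+n]*[m+n]/4≤m*n m n n≈m = ≤-pred (m<n*o⇒m/o<n (square<4[1+product] n≈m))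
  where
  square<4[1+product] : n ≡ m ⊎ n ≡ suc m → (m + n) * (m + n) < suc (m * n) * 4
  square<4[1+product] (inj₁ refl) = ≤-trans (≤-reflexive (even m)) (m≤n+m _ 3)
    where
    even : ∀ m → suc ((m + m) * (m + m)) ≡ 1 + m * m * 4
    even = solve-∀
  square<4[1+product] (inj₂ refl) = ≤-trans (≤-reflexive (odd m)) (m≤n+m _ 2)
    where
    odd : ∀ m → suc ((m + suc m) * (m + suc m)) ≡ 2 + m * suc m * 4
    odd = solve-∀

⌈n/2⌉≡⌊n/2⌋⊎⌈n/2⌉≡1+⌊n/2⌋ : ∀ n → ⌈ n /2⌉ ≡ ⌊ n /2⌋ ⊎ ⌈ n /2⌉ ≡ suc ⌊ n /2⌋
⌈n/2⌉≡⌊n/2⌋⊎⌈n/2⌉≡1+⌊n/2⌋ zero          = inj₁ refl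
⌈n/2⌉≡⌊n/2⌋⊎⌈n/2⌉≡1+⌊n/2⌋ (suc zero)    = inj₂ refl
⌈n/2⌉≡⌊n/2⌋⊎⌈n/2⌉≡1+⌊n/2⌋ (suc (suc n)) =
  Sum.map (cong suc) (cong suc) (⌈n/2⌉≡⌊n/2⌋⊎⌈n/2⌉≡1+⌊n/2⌋ n)

n*n/4≤⌊n/2⌋*⌈n/2⌉ : ∀ n → n * n / 4 ≤ ⌊ n /2⌋ * ⌈ n /2⌉
n*n/4≤⌊n/2⌋*⌈n/2⌉ n = subst (λ m → m * m / 4 ≤ ⌊ n /2⌋ * ⌈ n /2⌉) (⌊n/2⌋+⌈n/2⌉≡n n)
  ([m+n]*[m+n]/4≤m*n ⌊ n /2⌋ ⌈ n /2⌉ (⌈n/2⌉≡⌊n/2⌋⊎⌈n/2⌉≡1+⌊n/2⌋ n))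

arcCount-lowToHigh-⌊n/2⌋ : ∀ n → arcCount (lowToHigh n ⌊ n /2⌋) ≡ ⌊ n /2⌋ * ⌈ n /2⌉
arcCount-lowToHigh-⌊n/2⌋ n = begin
  arcCount (lowToHigh n ⌊ n /2⌋)      ≡⟨ arcCount-lowToHigh n ⌊ n /2⌋ ⟩
  (⌊ n /2⌋ ⊓ n) * (n ∸ ⌊ n /2⌋)       ≡⟨ cong₂ _*_ (m≤n⇒m⊓n≡m (⌊n/2⌋≤n n)) n∸⌊n/2⌋≡⌈n/2⌉ ⟩
  ⌊ n /2⌋ * ⌈ n /2⌉                   ∎
  where
  open ≡-Reasoning
  n∸⌊n/2⌋≡⌈n/2⌉ : n ∸ ⌊ n /2⌋ ≡ ⌈ n /2⌉
  n∸⌊n/2⌋≡⌈n/2⌉ = trans (cong (_∸ ⌊ n /2⌋) (sym (⌊n/2⌋+⌈n/2⌉≡n n))) (m+n∸m≡n ⌊ n /2⌋ ⌈ n /2⌉)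

lemma6 : ∀ (n k : ℕ) → 2 ≤ n → 2 ≤ k →
    Σ (Digraph n) (λ G → KGeodetic k G × (n * n) / 4 ≤ arcCount G)
lemma6 n k _ _ =
  lowToHigh n ⌊ n /2⌋ ,
  noTwoWalks⇒KGeodetic (lowToHigh n ⌊ n /2⌋) (lowToHigh-noTwoWalks n ⌊ n /2⌋) k ,
  subst (n * n / 4 ≤_) (sym (arcCount-lowToHigh-⌊n/2⌋ n)) (n*n/4≤⌊n/2⌋*⌈n/2⌉ n)
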